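{- Let $l$ be an odd prime and $\Lambda=\mathbb{Z}_l[[T]]$. Then $T^2\Lambda=\Xi_2\oplus(l-\psi)T\Lambda$.
   Context: $\psi$ is the $\mathbb{Z}_l$-algebra endomorphism with $\psi(T)=(1+T)^l-1$. $\Xi_2=\{\sum_{k\ge2}x_kT^k\in\mathbb{Z}_l[[T]]: x_k=0 \text{ whenever } l\mid k\}$. -}

module Defs where

open import Data.Nat as ℕ using (ℕ; zero; suc; _∸_)
import Data.Nat.Divisibility as ℕᵈ
open import Data.Nat.Combinatorics using (_C_)
open import Data.Integer as ℤ using (ℤ; +_; _+_; _-_; -_; _*_)
open import Data.Integer.Divisibility.Signed using (_∣_; divides; ∣m∣n⇒∣m+n; ∣m⇒∣-m; ∣n⇒∣m*n; ∣m⇒∣m*n)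
open import Data.Integer.Tactic.RingSolver using (solve-∀)
open import Data.Product using (Σ; _×_; _,_)
open import Relation.Binary.PropositionalEquality using (_≡_; refl; subst; sym)

∣0 : ∀ {k} → k ∣ + 0
∣0 {k} = divides (+ 0) (sym (ℤ.*-zeroˡ k))
  where import Data.Integer.Properties as ℤ

Serℤ : Set
Serℤ = ℕ → ℤ

sumℤ : ℕ → (ℕ → ℤ) → ℤ
sumℤ zero    f = + 0
sumℤ (suc n) f = sumℤ n f + f n

_*ˢ_ : Serℤ → Serℤ → Serℤ
(f *ˢ g) k = sumℤ (suc k) (λ i → f i * g (k ∸ i))

oneˢ : Serℤ
oneˢ zero    = + 1
oneˢ (suc _) = + 0

_^ˢ_ : Serℤ → ℕ → Serℤ
f ^ˢ zero  = oneˢ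
f ^ˢ suc j = f *ˢ (f ^ˢ j)

module _ (l : ℕ) where

  -- the l-adic integers ℤ_l = lim ℤ/l^n, as coherent sequences of integers:
  -- x = (x_n)_n with x_{n+1} ≡ x_n (mod l^n)
  record ℤₗ : Set where
    constructor mkℤₗ
    field
      seq : ℕ → ℤ
      coh : ∀ n → (+ (l ℕ.^ n)) ∣ (seq (suc n) - seq n)
  open ℤₗ public

  _≈ₗ_ : ℤₗ → ℤₗ → Set
  x ≈ₗ y = ∀ n → (+ (l ℕ.^ n)) ∣ (seq x n - seq y n)

  private
    add-eq : ∀ a a' b b' → (a' + b') - (a + b) ≡ (a' - a) + (b' - b)
    add-eq = solve-∀
    mul-eq : ∀ a a' b b' → (a' * b') - (a * b) ≡ a' * (b' - b) + (a' - a) * b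
    mul-eq = solve-∀
    neg-eq : ∀ a a' → (- a') - (- a) ≡ - (a' - a)
    neg-eq = solve-∀
    const-eq : ∀ a → a - a ≡ + 0
    const-eq = solve-∀

  ιₗ : ℤ → ℤₗ
  ιₗ a = mkℤₗ (λ _ → a) (λ n → subst (_ ∣_) (sym (const-eq a)) ∣0)

  _+ₗ_ : ℤₗ → ℤₗ → ℤₗ
  x +ₗ y = mkℤₗ (λ n → seq x n + seq y n)
    (λ n → subst (_ ∣_) (sym (add-eq (seq x n) (seq x (suc n)) (seq y n) (seq y (suc n))))
                 (∣m∣n⇒∣m+n (coh x n) (coh y n)))

  -ₗ_ : ℤₗ → ℤₗ
  -ₗ x = mkℤₗ (λ n → - seq x n)
    (λ n → subst (_ ∣_) (sym (neg-eq (seq x n) (seq x (suc n)))) (∣m⇒∣-m (coh x n)))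

  _*ₗ_ : ℤₗ → ℤₗ → ℤₗ
  x *ₗ y = mkℤₗ (λ n → seq x n * seq y n)
    (λ n → subst (_ ∣_) (sym (mul-eq (seq x n) (seq x (suc n)) (seq y n) (seq y (suc n))))
                 (∣m∣n⇒∣m+n (∣n⇒∣m*n (seq x (suc n)) (coh y n)) (∣m⇒∣m*n (seq y n) (coh x n))))

  sumₗ : ℕ → (ℕ → ℤₗ) → ℤₗ
  sumₗ zero    f = ιₗ (+ 0)
  sumₗ (suc n) f = sumₗ n f +ₗ f n

  Λ : Set
  Λ = ℕ → ℤₗ

  _≈_ : Λ → Λ → Set
  f ≈ g = ∀ k → f k ≈ₗ g k

  _⊕_ : Λ → Λ → Λ
  (f ⊕ g) k = f k +ₗ g k

  _⊖_ : Λ → Λ → Λ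
  (f ⊖ g) k = f k +ₗ (-ₗ g k)

  _⊛_ : Λ → Λ → Λ
  (f ⊛ g) k = sumₗ (suc k) (λ i → f i *ₗ g (k ∸ i))

  _·_ : ℤ → Λ → Λ
  (a · f) k = ιₗ a *ₗ f k

  0Λ : Λ
  0Λ _ = ιₗ (+ 0)

  T : Λ
  T (suc zero) = ιₗ (+ 1)
  T _          = ιₗ (+ 0)

  -- u = (1+T)^l - 1 = Σ_{k ≥ 1} (l choose k) T^k, with integer coefficients
  u : Serℤ
  u zero    = + 0
  u (suc k) = + (l C suc k)

  -- ψ : the (continuous) ℤ_l-algebra endomorphism of Λ with ψ(T) = (1+T)^l - 1,
  -- i.e. substitution ψ(f)(T) = f((1+T)^l - 1) = Σ_j f_j u^j.
  -- Since u has no constant term, u^j has no coefficients below degree j, so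
  -- coefficient k of ψ(f) is the finite sum Σ_{j ≤ k} f_j (u^j)_k.
  ψ : Λ → Λ
  ψ f k = sumₗ (suc k) (λ j → ιₗ ((u ^ˢ j) k) *ₗ f j)

  l-ψ : Λ → Λ
  l-ψ f = ((+ l) · f) ⊖ ψ f

  Ξ₂ : Λ → Set
  Ξ₂ x = (x 0 ≈ₗ ιₗ (+ 0)) × (x 1 ≈ₗ ιₗ (+ 0))
       × (∀ k → l ℕᵈ.∣ k → x k ≈ₗ ιₗ (+ 0))

  InT²Λ : Λ → Set
  InT²Λ g = Σ Λ λ h → g ≈ (T ⊛ (T ⊛ h))

  In[l-ψ]TΛ : Λ → Set
  In[l-ψ]TΛ g = Σ Λ λ h → g ≈ l-ψ (T ⊛ h)

module Submission where

-- Since ℤ_l is the limit of the ℤ/l^n, everything is reduced to integer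
-- coefficient sequences F read at a fixed precision l^n, where l - ψ becomes an
-- explicit operator l-ψᶻ.  From l ∣ (l C k) for 0 < k < l we get u^j ≡ T^(lj)
-- (mod l) for u = (1+T)^l - 1, hence ((l-ψ)F)_{kl} ≡ -F_k (mod l).  So the
-- linear map Φ F = F + ((l-ψ)F)_{l·} is ≡ 0 (mod l): it is an l-adic contraction.
--  * Uniqueness: if (l-ψ)F vanishes at the multiples of l then Φ F = F, so F ≡ 0
--    modulo every l^i, i ≤ n; applied to F = T h this kills Ξ₂ ∩ (l-ψ)TΛ.
--  * Existence: iterating F ↦ Φ F - G solves ((l-ψ)F)_{kl} = g_{kl} modulo l^n;
--    the n-th iterates are coherent in n and define h, and x = g - (l-ψ)(T h) ∈ Ξ₂.
--  * Ξ₂ + (l-ψ)TΛ ⊆ T²Λ, as T²Λ consists of the series whose T⁰ and T¹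
--    coefficients vanish, and ((l-ψ)F)_0 = (l-1)F_0, ((l-ψ)F)_1 = 0.

open import Defs
open import Data.Nat as ℕ using (ℕ; zero; suc; _∸_; _≤_; _<_; z≤n; s≤s; _!)
import Data.Nat.Properties as ℕₚ
import Data.Nat.Divisibility as ℕᵈ
open import Data.Nat.DivMod using (m*[n/m]≡n)
open import Data.Nat.Combinatorics using (_C_; nCk≡n!/k![n-k]!; k![n∸k]!∣n!; nCn≡1; k>n⇒nCk≡0; nC1≡n)
open import Data.Nat.Primality using (Prime; euclidsLemma; prime⇒nonTrivial; prime⇒nonZero)
open import Data.Integer using (ℤ; +_; _+_; _-_; -_; _*_)
import Data.Integer.Properties as ℤₚ
open import Data.Integer.Divisibility.Signed
  using (_∣_; divides; quotient; ∣ᵤ⇒∣; ∣-refl; ∣-trans; ∣m∣n⇒∣m+n; ∣m⇒∣-m; ∣n⇒∣m*n; ∣m⇒∣m*n; *-monoʳ-∣)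
open import Data.Integer.Tactic.RingSolver using (solve-∀)
open import Data.Product using (Σ; _×_; _,_; proj₁; proj₂)
open import Data.Sum using (inj₁; inj₂)
open import Data.Empty using (⊥-elim)
open import Level using (0ℓ)
open import Relation.Nullary using (yes; no)
open import Relation.Binary.Bundles using (Setoid)
open import Relation.Binary.Definitions using (tri<; tri≈; tri>)
open import Relation.Binary.PropositionalEquality
  using (_≡_; _≢_; refl; sym; trans; cong; cong₂; subst; subst₂; module ≡-Reasoning)
import Relation.Binary.Reasoning.Setoid as SetoidReasoning

-- Congruence of integers modulo M.  It is a record (rather than the bare
-- divisibility M ∣ a - b) so that a and b can be inferred from its type.
infix 4 _≅_mod_
record _≅_mod_ (a b M : ℤ) : Set where
  constructor mod-by
  field divides-difference : M ∣ a - b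
open _≅_mod_ public

module _ {M : ℤ} where

  ≡⇒≅ : ∀ {a b} → a ≡ b → a ≅ b mod M
  ≡⇒≅ {a} refl = mod-by (divides (+ 0) (trans (ℤₚ.+-inverseʳ a) (sym (ℤₚ.*-zeroˡ M))))

  ≅-refl : ∀ {a} → a ≅ a mod M
  ≅-refl = ≡⇒≅ refl

  ≅-sym : ∀ {a b} → a ≅ b mod M → b ≅ a mod M
  ≅-sym {a} {b} (mod-by p) = mod-by (subst (M ∣_) (swap a b) (∣m⇒∣-m p))
    where swap : ∀ a b → - (a - b) ≡ b - a
          swap = solve-∀

  ≅-trans : ∀ {a b c} → a ≅ b mod M → b ≅ c mod M → a ≅ c mod M
  ≅-trans {a} {b} {c} (mod-by p) (mod-by q) = mod-by (subst (M ∣_) (telescope a b c) (∣m∣n⇒∣m+n p q))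
    where telescope : ∀ a b c → (a - b) + (b - c) ≡ a - c
          telescope = solve-∀

  ≅-+ : ∀ {a b c d} → a ≅ b mod M → c ≅ d mod M → a + c ≅ b + d mod M
  ≅-+ {a} {b} {c} {d} (mod-by p) (mod-by q) = mod-by (subst (M ∣_) (regroup a b c d) (∣m∣n⇒∣m+n p q))
    where regroup : ∀ a b c d → (a - b) + (c - d) ≡ (a + c) - (b + d)
          regroup = solve-∀

  ≅-neg : ∀ {a b} → a ≅ b mod M → - a ≅ - b mod M
  ≅-neg {a} {b} (mod-by p) = mod-by (subst (M ∣_) (regroup a b) (∣m⇒∣-m p))
    where regroup : ∀ a b → - (a - b) ≡ (- a) - (- b)
          regroup = solve-∀

  ≅-* : ∀ {a b c d} → a ≅ b mod M → c ≅ d mod M → a * c ≅ b * d mod M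
  ≅-* {a} {b} {c} {d} (mod-by p) (mod-by q) =
    mod-by (subst (M ∣_) (regroup a b c d) (∣m∣n⇒∣m+n (∣n⇒∣m*n a q) (∣m⇒∣m*n d p)))
    where regroup : ∀ a b c d → a * (c - d) + (a - b) * d ≡ a * c - b * d
          regroup = solve-∀

  ∣⇒≅0 : ∀ {a} → M ∣ a → a ≅ + 0 mod M
  ∣⇒≅0 {a} p = mod-by (subst (M ∣_) (sym (ℤₚ.+-identityʳ a)) p)

  ≅0⇒∣ : ∀ {a} → a ≅ + 0 mod M → M ∣ a
  ≅0⇒∣ {a} (mod-by p) = subst (M ∣_) (ℤₚ.+-identityʳ a) p

  ≅-setoid : Setoid 0ℓ 0ℓ
  ≅-setoid = record
    { Carrier       = ℤ
    ; _≈_           = λ a b → a ≅ b mod M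
    ; isEquivalence = record { refl = ≅-refl ; sym = ≅-sym ; trans = ≅-trans }
    }

≅-mod-1 : ∀ {a b} → a ≅ b mod + 1
≅-mod-1 {a} {b} = mod-by (divides (a - b) (sym (ℤₚ.*-identityʳ (a - b))))

≅-weaken : ∀ {M N a b} → M ∣ N → a ≅ b mod N → a ≅ b mod M
≅-weaken M∣N (mod-by p) = mod-by (∣-trans M∣N p)

module ≅-Reasoning (M : ℤ) = SetoidReasoning (≅-setoid {M})

sum-cong : ∀ n {f g} → (∀ i → f i ≡ g i) → sumℤ n f ≡ sumℤ n g
sum-cong zero    f≡g = refl
sum-cong (suc n) f≡g = cong₂ _+_ (sum-cong n f≡g) (f≡g n)

sum-≅ : ∀ {M} n {f g} → (∀ i → f i ≅ g i mod M) → sumℤ n f ≅ sumℤ n g mod M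
sum-≅ zero    f≡g = ≅-refl
sum-≅ (suc n) f≡g = ≅-+ (sum-≅ n f≡g) (f≡g n)

sum-linear : ∀ n a b (f g : ℕ → ℤ) → sumℤ n (λ i → a * f i + b * g i) ≡ a * sumℤ n f + b * sumℤ n g
sum-linear zero    a b f g = nought a b
  where nought : ∀ a b → + 0 ≡ a * + 0 + b * + 0
        nought = solve-∀
sum-linear (suc n) a b f g =
  trans (cong (_+ (a * f n + b * g n)) (sum-linear n a b f g)) (regroup a b _ _ (f n) (g n))
  where regroup : ∀ a b s t x y → (a * s + b * t) + (a * x + b * y) ≡ a * (s + x) + b * (t + y)
        regroup = solve-∀

sum-vanishing : ∀ n {f} → (∀ i → i < n → f i ≡ + 0) → sumℤ n f ≡ + 0
sum-vanishing zero    f≡0 = refl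
sum-vanishing (suc n) f≡0 =
  cong₂ _+_ (sum-vanishing n (λ i i<n → f≡0 i (ℕₚ.m<n⇒m<1+n i<n))) (f≡0 n ℕₚ.≤-refl)

sum-single : ∀ n p {f} → p < n → (∀ i → i ≢ p → f i ≡ + 0) → sumℤ n f ≡ f p
sum-single (suc n) p {f} p<1+n others≡0 with n ℕ.≟ p
... | yes refl = trans (cong (_+ f n) (sum-vanishing n (λ i i<n → others≡0 i (ℕₚ.<⇒≢ i<n))))
                       (ℤₚ.+-identityˡ (f n))
... | no n≢p   = trans (cong₂ _+_ (sum-single n p p<n others≡0) (others≡0 n n≢p)) (ℤₚ.+-identityʳ (f p))
  where p<n = ℕₚ.≤∧≢⇒< (ℕₚ.≤-pred p<1+n) (λ p≡n → n≢p (sym p≡n))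

-- The Kronecker delta; δ m p is the m-th coefficient of the monomial T^p.
δ : ℕ → ℕ → ℤ
δ a b with a ℕ.≟ b
... | yes _ = + 1
... | no _  = + 0

δ-≡ : ∀ {a b} → a ≡ b → δ a b ≡ + 1
δ-≡ {a} {b} a≡b with a ℕ.≟ b
... | yes _  = refl
... | no a≢b = ⊥-elim (a≢b a≡b)

δ-≢ : ∀ {a b} → a ≢ b → δ a b ≡ + 0
δ-≢ {a} {b} a≢b with a ℕ.≟ b
... | yes a≡b = ⊥-elim (a≢b a≡b)
... | no _    = refl

δ-⇔ : ∀ {a b c d} → (a ≡ b → c ≡ d) → (c ≡ d → a ≡ b) → δ a b ≡ δ c d
δ-⇔ {a} {b} ab⇒cd cd⇒ab with a ℕ.≟ b
... | yes a≡b = sym (δ-≡ (ab⇒cd a≡b))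
... | no a≢b  = sym (δ-≢ (λ c≡d → a≢b (cd⇒ab c≡d)))

δ-≢-* : ∀ {i p} x → i ≢ p → δ i p * x ≡ + 0
δ-≢-* {i} {p} x i≢p = trans (cong (_* x) (δ-≢ i≢p)) (ℤₚ.*-zeroˡ x)

sum-δ : ∀ n p (f : ℕ → ℤ) → p < n → sumℤ n (λ i → δ i p * f i) ≡ f p
sum-δ n p f p<n = trans (sum-single n p {λ i → δ i p * f i} p<n (λ i → δ-≢-* (f i)))
                        (trans (cong (_* f p) (δ-≡ {p} refl)) (ℤₚ.*-identityˡ (f p)))

-- T^a · T^b = T^(a+b), coefficientwise
δ-convolution : ∀ a b m → sumℤ (suc m) (λ i → δ i a * δ (m ∸ i) b) ≡ δ m (a ℕ.+ b)
δ-convolution a b m with a ℕ.≤? m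
... | yes a≤m = trans (sum-δ (suc m) a (λ i → δ (m ∸ i) b) (s≤s a≤m))
                      (δ-⇔ (λ m∸a≡b → trans (sym (ℕₚ.m+[n∸m]≡n a≤m)) (cong (a ℕ.+_) m∸a≡b))
                           (λ m≡a+b → trans (cong (_∸ a) m≡a+b) (ℕₚ.m+n∸m≡n a b)))
... | no a≰m  = trans (sum-vanishing (suc m) {λ i → δ i a * δ (m ∸ i) b} (λ i i≤m → δ-≢-* _ (i≢a i≤m)))
                      (sym (δ-≢ (λ m≡a+b → a≰m (subst (a ≤_) (sym m≡a+b) (ℕₚ.m≤m+n a b)))))
  where i≢a : ∀ {i} → i < suc m → i ≢ a
        i≢a i≤m refl = a≰m (ℕₚ.≤-pred i≤m)

module _ {l : ℕ} (l-prime : Prime l) where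

  private
    1<l : 1 < l
    1<l = ℕ.nonTrivial⇒n>1 l {{prime⇒nonTrivial l-prime}}

  prime∣!⇒≤ : ∀ m → l ℕᵈ.∣ m ! → l ≤ m
  prime∣!⇒≤ zero    l∣1 = ⊥-elim (ℕₚ.<-irrefl (sym (ℕᵈ.∣1⇒≡1 l∣1)) 1<l)
  prime∣!⇒≤ (suc m) l∣m! with euclidsLemma (suc m) (m !) l-prime l∣m!
  ... | inj₁ l∣1+m = ℕᵈ.∣⇒≤ l∣1+m
  ... | inj₂ l∣m!  = ℕₚ.m≤n⇒m≤1+n (prime∣!⇒≤ m l∣m!)

  private
    n∣n! : ∀ n → 0 < n → n ℕᵈ.∣ n !
    n∣n! (suc n) _ = ℕᵈ.m∣m*n (n !)

    -- k! (l-k)! (l C k) = l!, which l divides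
    l∣k![l-k]!C : ∀ k → k ≤ l → l ℕᵈ.∣ (k ! ℕ.* (l ∸ k) !) ℕ.* (l C k)
    l∣k![l-k]!C k k≤l = subst (l ℕᵈ.∣_) (sym k![l-k]!C≡l!) (n∣n! l (ℕₚ.<-trans ℕₚ.0<1+n 1<l))
      where
        k![l-k]!C≡l! : (k ! ℕ.* (l ∸ k) !) ℕ.* (l C k) ≡ l !
        k![l-k]!C≡l! = trans (cong ((k ! ℕ.* (l ∸ k) !) ℕ.*_) (nCk≡n!/k![n-k]! k≤l))
                             (m*[n/m]≡n {{k ℕₚ.!* (l ∸ k) !≢0}} (k![n∸k]!∣n! k≤l))

  prime∣binomial : ∀ k → 0 < k → k < l → l ℕᵈ.∣ l C k
  prime∣binomial k 0<k k<l with euclidsLemma (k ! ℕ.* (l ∸ k) !) (l C k) l-prime (l∣k![l-k]!C k (ℕₚ.<⇒≤ k<l))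
  ... | inj₂ l∣C = l∣C
  ... | inj₁ l∣k![l-k]! with euclidsLemma (k !) ((l ∸ k) !) l-prime l∣k![l-k]!
  ...   | inj₁ l∣k!     = ⊥-elim (ℕₚ.<⇒≱ k<l (prime∣!⇒≤ k l∣k!))
  ...   | inj₂ l∣[l-k]! = ⊥-elim (ℕₚ.<⇒≱ (ℕₚ.∸-monoʳ-< 0<k (ℕₚ.<⇒≤ k<l)) (prime∣!⇒≤ (l ∸ k) l∣[l-k]!))

  u≅T^l : ∀ i → u l i ≅ δ i l mod + l
  u≅T^l zero = ≡⇒≅ (sym (δ-≢ (λ 0≡l → ℕₚ.<⇒≢ (ℕₚ.<-trans ℕₚ.0<1+n 1<l) 0≡l)))
  u≅T^l (suc k) with ℕₚ.<-cmp (suc k) l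
  ... | tri< k<l k≢l _ = ≅-trans (∣⇒≅0 (∣ᵤ⇒∣ (prime∣binomial (suc k) ℕₚ.0<1+n k<l))) (≡⇒≅ (sym (δ-≢ k≢l)))
  ... | tri≈ _ refl _  = ≡⇒≅ (trans (cong +_ (nCn≡1 (suc k))) (sym (δ-≡ {suc k} refl)))
  ... | tri> _ k≢l k>l = ≡⇒≅ (trans (cong +_ (k>n⇒nCk≡0 k>l)) (sym (δ-≢ k≢l)))

  u^j≅T^lj : ∀ j m → (u l ^ˢ j) m ≅ δ m (l ℕ.* j) mod + l
  u^j≅T^lj zero m rewrite ℕₚ.*-zeroʳ l = ≡⇒≅ (one≡δ0 m)
    where one≡δ0 : ∀ m → oneˢ m ≡ δ m 0
          one≡δ0 zero    = refl
          one≡δ0 (suc m) = refl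
  u^j≅T^lj (suc j) m = begin
    sumℤ (suc m) (λ i → u l i * (u l ^ˢ j) (m ∸ i))
      ≈⟨ sum-≅ (suc m) (λ i → ≅-* (u≅T^l i) (u^j≅T^lj j (m ∸ i))) ⟩
    sumℤ (suc m) (λ i → δ i l * δ (m ∸ i) (l ℕ.* j))
      ≡⟨ δ-convolution l (l ℕ.* j) m ⟩
    δ m (l ℕ.+ l ℕ.* j)
      ≡⟨ cong (δ m) (sym (ℕₚ.*-suc l j)) ⟩
    δ m (l ℕ.* suc j) ∎
    where open ≅-Reasoning (+ l)

-- Precision-n shadow of l - ψ.  A series of Λ is seen at precision l^n through
-- its integer coefficient sequence F; there l - ψ acts by
--   ((l-ψ)F)_m = l F_m - Σ_{j≤m} (u^j)_m F_j.
module Precision (l : ℕ) where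

  l^_ : ℕ → ℤ
  l^ n = + (l ℕ.^ n)

  l^-suc : ∀ i → l^ suc i ≡ l^ i * + l
  l^-suc i = trans (ℤₚ.pos-* l (l ℕ.^ i)) (ℤₚ.*-comm (+ l) (l^ i))

  l^-∣ : ∀ {i n} → i ≤ n → l^ i ∣ l^ n
  l^-∣ {i} {n} i≤n = ∣ᵤ⇒∣ (ℕᵈ.divides (l ℕ.^ (n ∸ i)) (begin
    l ℕ.^ n                       ≡⟨ cong (l ℕ.^_) (ℕₚ.m+[n∸m]≡n i≤n) ⟨
    l ℕ.^ (i ℕ.+ (n ∸ i))         ≡⟨ ℕₚ.^-distribˡ-+-* l i (n ∸ i) ⟩
    l ℕ.^ i ℕ.* l ℕ.^ (n ∸ i)     ≡⟨ ℕₚ.*-comm (l ℕ.^ i) _ ⟩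
    l ℕ.^ (n ∸ i) ℕ.* l ℕ.^ i     ∎))
    where open ≡-Reasoning

  l-ψᶻ : (ℕ → ℤ) → ℕ → ℤ
  l-ψᶻ F m = + l * F m - sumℤ (suc m) (λ j → (u l ^ˢ j) m * F j)

  l-ψᶻ-cong : ∀ {F G} → (∀ j → F j ≡ G j) → ∀ m → l-ψᶻ F m ≡ l-ψᶻ G m
  l-ψᶻ-cong F≡G m = cong₂ _-_ (cong (+ l *_) (F≡G m)) (sum-cong (suc m) (λ j → cong ((u l ^ˢ j) m *_) (F≡G j)))

  l-ψᶻ-≅ : ∀ {M F G} → (∀ j → F j ≅ G j mod M) → ∀ m → l-ψᶻ F m ≅ l-ψᶻ G m mod M
  l-ψᶻ-≅ F≅G m = ≅-+ (≅-* (≅-refl {a = + l}) (F≅G m)) (≅-neg (sum-≅ (suc m) (λ j → ≅-* (≅-refl {a = (u l ^ˢ j) m}) (F≅G j))))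

  l-ψᶻ-linear : ∀ a b F G m → l-ψᶻ (λ j → a * F j + b * G j) m ≡ a * l-ψᶻ F m + b * l-ψᶻ G m
  l-ψᶻ-linear a b F G m =
    trans (cong (λ s → + l * (a * F m + b * G m) - s)
                (trans (sum-cong (suc m) (λ j → distribute ((u l ^ˢ j) m) a b (F j) (G j)))
                       (sum-linear (suc m) a b (λ j → (u l ^ˢ j) m * F j) (λ j → (u l ^ˢ j) m * G j))))
          (regroup (+ l) a b (F m) (G m) _ _)
    where
      distribute : ∀ c a b x y → c * (a * x + b * y) ≡ a * (c * x) + b * (c * y)
      distribute = solve-∀
      regroup : ∀ L a b x y s t → L * (a * x + b * y) - (a * s + b * t) ≡ a * (L * x - s) + b * (L * y - t)
      regroup = solve-∀

  l-ψᶻ-of-0 : ∀ m → l-ψᶻ (λ _ → + 0) m ≡ + 0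
  l-ψᶻ-of-0 m = trans (cong (λ s → + l * + 0 - s) (sum-vanishing (suc m) (λ j _ → ℤₚ.*-zeroʳ ((u l ^ˢ j) m))))
                      (nought (+ l))
    where nought : ∀ L → L * + 0 - + 0 ≡ + 0
          nought = solve-∀

  -- ((l-ψ)F)_0 = (l - 1) F_0
  l-ψᶻ-at-0 : ∀ F → F 0 ≡ + 0 → l-ψᶻ F 0 ≡ + 0
  l-ψᶻ-at-0 F F₀≡0 = trans (cong (λ x → + l * x - (+ 0 + + 1 * x)) F₀≡0) (nought (+ l))
    where nought : ∀ L → L * + 0 - (+ 0 + + 1 * + 0) ≡ + 0
          nought = solve-∀

  u-at-1 : (u l ^ˢ 1) 1 ≡ + l
  u-at-1 = trans (simplify (+ (l C 1))) (cong +_ (nC1≡n l))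
    where simplify : ∀ c → (+ 0 + + 0 * + 0) + c * + 1 ≡ c
          simplify = solve-∀

  -- ((l-ψ)F)_1 = l F_1 - (u^0)_1 F_0 - (u^1)_1 F_1 = l F_1 - 0 - l F_1 = 0
  l-ψᶻ-at-1 : ∀ F → l-ψᶻ F 1 ≡ + 0
  l-ψᶻ-at-1 F = trans (cong (λ c → + l * F 1 - ((+ 0 + + 0 * F 0) + c * F 1)) u-at-1) (cancel (+ l) (F 0) (F 1))
    where cancel : ∀ L a b → L * b - ((+ 0 + + 0 * a) + L * b) ≡ + 0
          cancel = solve-∀

  -- Φ F = F + ((l-ψ)F restricted to the multiples of l): the correction that
  -- drives the iterative solution of (l-ψ)F = G on multiples of l.
  Φ : (ℕ → ℤ) → ℕ → ℤ
  Φ F k = F k + l-ψᶻ F (k ℕ.* l)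

  Φ-cong : ∀ {F G} → (∀ j → F j ≡ G j) → ∀ k → Φ F k ≡ Φ G k
  Φ-cong F≡G k = cong₂ _+_ (F≡G k) (l-ψᶻ-cong F≡G (k ℕ.* l))

  Φ-≅ : ∀ {M F G} → (∀ j → F j ≅ G j mod M) → ∀ k → Φ F k ≅ Φ G k mod M
  Φ-≅ F≅G k = ≅-+ (F≅G k) (l-ψᶻ-≅ F≅G (k ℕ.* l))

  Φ-linear : ∀ a b F G k → Φ (λ j → a * F j + b * G j) k ≡ a * Φ F k + b * Φ G k
  Φ-linear a b F G k =
    trans (cong (_+_ (a * F k + b * G k)) (l-ψᶻ-linear a b F G (k ℕ.* l)))
          (regroup a b (F k) (G k) (l-ψᶻ F (k ℕ.* l)) (l-ψᶻ G (k ℕ.* l)))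
    where regroup : ∀ a b x y s t → (a * x + b * y) + (a * s + b * t) ≡ a * (x + s) + b * (y + t)
          regroup = solve-∀

  Φ-at-0 : ∀ F → F 0 ≡ + 0 → Φ F 0 ≡ + 0
  Φ-at-0 F F₀≡0 = cong₂ _+_ F₀≡0 (l-ψᶻ-at-0 F F₀≡0)

  Φ-of-0 : ∀ k → Φ (λ _ → + 0) k ≡ + 0
  Φ-of-0 k = cong (_+_ (+ 0)) (l-ψᶻ-of-0 (k ℕ.* l))

  -- The iteration F ↦ Φ F - G, started at 0.  A fixed point F satisfies
  -- ((l-ψ)F)_{kl} = G_k for all k; Φ being a contraction, the m-th iterate is
  -- such a fixed point modulo l^m.
  iterate : (ℕ → ℤ) → ℕ → ℕ → ℤ
  iterate G zero    k = + 0
  iterate G (suc m) k = Φ (iterate G m) k - G k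

  -- the iterates keep a vanishing constant coefficient, so they come from TΛ
  iterate-at-0 : ∀ G → G 0 ≡ + 0 → ∀ m → iterate G m 0 ≡ + 0
  iterate-at-0 G G₀≡0 zero    = refl
  iterate-at-0 G G₀≡0 (suc m) = cong₂ _-_ (Φ-at-0 (iterate G m) (iterate-at-0 G G₀≡0 m)) G₀≡0

  iterate-≅ : ∀ {M G G′} → (∀ k → G k ≅ G′ k mod M) → ∀ m k → iterate G m k ≅ iterate G′ m k mod M
  iterate-≅ G≅G′ zero    k = ≅-refl
  iterate-≅ G≅G′ (suc m) k = ≅-+ (Φ-≅ (iterate-≅ G≅G′ m) k) (≅-neg (G≅G′ k))

module Contraction {l : ℕ} (l-prime : Prime l) where

  open Precision l

  private instance
    l≢0 : ℕ.NonZero l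
    l≢0 = prime⇒nonZero l-prime

  -- Φ F ≡ 0 (mod l): modulo l, ψ acts as T ↦ T^l, so ((l-ψ)F)_{kl} ≡ -F_k.
  Φ≅0 : ∀ F k → Φ F k ≅ + 0 mod + l
  Φ≅0 F k = begin
    F k + (+ l * F m - sumℤ (suc m) (λ j → (u l ^ˢ j) m * F j))
      ≈⟨ ≅-+ (≅-refl {a = F k}) (≅-+ (∣⇒≅0 (∣m⇒∣m*n (F m) ∣-refl))
            (≅-neg (sum-≅ (suc m) (λ j → ≅-* (u^j≅T^lj l-prime j m) (≅-refl {a = F j}))))) ⟩
    F k + (+ 0 - sumℤ (suc m) (λ j → δ m (l ℕ.* j) * F j))
      ≡⟨ cong (λ s → F k + (+ 0 - s)) picks-F-k ⟩
    F k + (+ 0 - F k)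
      ≡⟨ cancel (F k) ⟩
    + 0 ∎
    where
      open ≅-Reasoning (+ l)
      m = k ℕ.* l
      kl≡lj⇒j≡k : ∀ {j} → m ≡ l ℕ.* j → j ≡ k
      kl≡lj⇒j≡k {j} kl≡lj = ℕₚ.*-cancelʳ-≡ j k l (trans (ℕₚ.*-comm j l) (sym kl≡lj))
      j≡k⇒kl≡lj : ∀ {j} → j ≡ k → m ≡ l ℕ.* j
      j≡k⇒kl≡lj refl = ℕₚ.*-comm k l
      -- T^(lj) has a T^(kl)-coefficient exactly when j = k
      picks-F-k : sumℤ (suc m) (λ j → δ m (l ℕ.* j) * F j) ≡ F k
      picks-F-k = trans (sum-cong (suc m) (λ j → cong (_* F j) (δ-⇔ kl≡lj⇒j≡k j≡k⇒kl≡lj)))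
                        (sum-δ (suc m) k F (s≤s (ℕₚ.m≤m*n k l)))
      cancel : ∀ x → x + (+ 0 - x) ≡ + 0
      cancel = solve-∀

  -- Φ is an l-adic contraction: F ≡ G (mod l^i) implies Φ F ≡ Φ G (mod l^(i+1)),
  -- since Φ is linear and Φ ≡ 0 (mod l).
  Φ-contract : ∀ i {F G} → (∀ j → F j ≅ G j mod l^ i) → ∀ k → Φ F k ≅ Φ G k mod l^ suc i
  Φ-contract i {F} {G} F≅G k =
    mod-by (subst₂ _∣_ (sym (l^-suc i)) (sym ΦF-ΦG≡l^i·Φq) (*-monoʳ-∣ (l^ i) (≅0⇒∣ (Φ≅0 q k))))
    where
      q : ℕ → ℤ
      q j = quotient (divides-difference (F≅G j))
      F-G≡l^i·q : ∀ j → + 1 * F j + (- + 1) * G j ≡ l^ i * q j + + 0 * q j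
      F-G≡l^i·q j = trans (as-difference (F j) (G j))
                         (trans (_∣_.equality (divides-difference (F≅G j))) (reorder (q j) (l^ i)))
        where as-difference : ∀ x y → + 1 * x + (- + 1) * y ≡ x - y
              as-difference = solve-∀
              reorder : ∀ q p → q * p ≡ p * q + + 0 * q
              reorder = solve-∀
      ΦF-ΦG≡l^i·Φq : Φ F k - Φ G k ≡ l^ i * Φ q k
      ΦF-ΦG≡l^i·Φq = begin
        Φ F k - Φ G k                           ≡⟨ combination (Φ F k) (Φ G k) ⟩
        + 1 * Φ F k + (- + 1) * Φ G k           ≡⟨ Φ-linear (+ 1) (- + 1) F G k ⟨
        Φ (λ j → + 1 * F j + (- + 1) * G j) k   ≡⟨ Φ-cong F-G≡l^i·q k ⟩
        Φ (λ j → l^ i * q j + + 0 * q j) k      ≡⟨ Φ-linear (l^ i) (+ 0) q q k ⟩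
        l^ i * Φ q k + + 0 * Φ q k              ≡⟨ ℤₚ.+-identityʳ (l^ i * Φ q k) ⟩
        l^ i * Φ q k                            ∎
        where
          open ≡-Reasoning
          combination : ∀ x y → x - y ≡ + 1 * x + (- + 1) * y
          combination = solve-∀

  iterate-step : ∀ G m k → iterate G (suc m) k ≅ iterate G m k mod l^ m
  iterate-step G zero    k = ≅-mod-1
  iterate-step G (suc m) k = ≅-+ (Φ-contract m (iterate-step G m) k) (≅-refl {a = - G k})

  iterate-solves : ∀ G n k → l-ψᶻ (iterate G n) (k ℕ.* l) ≅ G k mod l^ n
  iterate-solves G n k =
    mod-by (subst (l^ n ∣_) (difference (iterate G n k) _ (G k)) (divides-difference (iterate-step G n k)))
    where difference : ∀ a b c → (a + b - c) - a ≡ b - c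
          difference = solve-∀

  vanishing-on-multiples : ∀ n F → (∀ k → l-ψᶻ F (k ℕ.* l) ≅ + 0 mod l^ n) → ∀ j → F j ≅ + 0 mod l^ n
  vanishing-on-multiples n F l-ψF≅0 = divisible-by n ℕₚ.≤-refl
    where
      Φ≅id : ∀ k → Φ F k ≅ F k mod l^ n
      Φ≅id k = ≅-trans (≅-+ (≅-refl {a = F k}) (l-ψF≅0 k)) (≡⇒≅ (ℤₚ.+-identityʳ (F k)))
      divisible-by : ∀ i → i ≤ n → ∀ j → F j ≅ + 0 mod l^ i
      divisible-by zero    _   j = ≅-mod-1
      divisible-by (suc i) i<n j = begin
        F j              ≈⟨ ≅-weaken (l^-∣ i<n) (Φ≅id j) ⟨
        Φ F j            ≈⟨ Φ-contract i (divisible-by i (ℕₚ.<⇒≤ i<n)) j ⟩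
        Φ (λ _ → + 0) j  ≡⟨ Φ-of-0 j ⟩
        + 0              ∎
        where open ≅-Reasoning (l^ suc i)

module Coefficients (l : ℕ) where

  open Precision l

  coeffs : Λ l → ℕ → ℕ → ℤ
  coeffs f n j = seq (f j) n

  seq-sumₗ : ∀ k f n → seq (sumₗ l k f) n ≡ sumℤ k (λ i → seq (f i) n)
  seq-sumₗ zero    f n = refl
  seq-sumₗ (suc k) f n = cong (_+ seq (f k) n) (seq-sumₗ k f n)

  coeffs-l-ψ : ∀ f n k → seq (l-ψ l f k) n ≡ l-ψᶻ (coeffs f n) k
  coeffs-l-ψ f n k = cong (λ s → + l * seq (f k) n - s) (seq-sumₗ (suc k) (λ j → _*ₗ_ l (ιₗ l ((u l ^ˢ j) k)) (f j)) n)

  T· : Λ l → Λ l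
  T· h = _⊛_ l (T l) h

  T·-at-0 : ∀ h n → seq (T· h 0) n ≡ + 0
  T·-at-0 h n = seq-sumₗ 1 (λ i → _*ₗ_ l (T l i) (h (0 ∸ i))) n

  T·-at-suc : ∀ h k n → seq (T· h (suc k)) n ≡ seq (h k) n
  T·-at-suc h k n = trans (seq-sumₗ (suc (suc k)) (λ i → _*ₗ_ l (T l i) (h (suc k ∸ i))) n)
                          (trans (sum-single (suc (suc k)) 1 (s≤s (s≤s z≤n)) T-other≡0)
                                 (ℤₚ.*-identityˡ (seq (h k) n)))
    where T-other≡0 : ∀ i → i ≢ 1 → seq (T l i) n * seq (h (suc k ∸ i)) n ≡ + 0
          T-other≡0 zero          _   = refl
          T-other≡0 (suc zero)    1≢1 = ⊥-elim (1≢1 refl)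
          T-other≡0 (suc (suc i)) _   = refl

  -- equality in ℤ_l is congruence modulo l^n at every precision n
  -- (stated with explicit x y, which cannot be inferred from the unfolded ≈ₗ)
  ≈ₗ⇒≅ : ∀ x y → _≈ₗ_ l x y → ∀ n → seq x n ≅ seq y n mod l^ n
  ≈ₗ⇒≅ x y x≈y n = mod-by (x≈y n)

  ≅⇒≈ₗ : ∀ x y → (∀ n → seq x n ≅ seq y n mod l^ n) → _≈ₗ_ l x y
  ≅⇒≈ₗ x y x≅y n = divides-difference (x≅y n)

  0ₗ : ℤₗ l
  0ₗ = ιₗ l (+ 0)

  -- the coefficients of T⁰ and T¹ vanish: this characterises the ideal T²Λ
  LowVanishing : Λ l → Set
  LowVanishing g = _≈ₗ_ l (g 0) 0ₗ × _≈ₗ_ l (g 1) 0ₗ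

  ≈-low-vanishing : ∀ {g f} → _≈_ l g f → (∀ n → seq (f 0) n ≡ + 0) → (∀ n → seq (f 1) n ≡ + 0) → LowVanishing g
  ≈-low-vanishing {g} {f} g≈f f₀≡0 f₁≡0 = vanishes 0 f₀≡0 , vanishes 1 f₁≡0
    where vanishes : ∀ k → (∀ n → seq (f k) n ≡ + 0) → _≈ₗ_ l (g k) 0ₗ
          vanishes k fₖ≡0 = ≅⇒≈ₗ (g k) 0ₗ (λ n → ≅-trans (≈ₗ⇒≅ (g k) (f k) (g≈f k) n) (≡⇒≅ (fₖ≡0 n)))

  ⊕-low-vanishing : ∀ {g x y} → _≈_ l g (_⊕_ l x y) → LowVanishing x → LowVanishing y → LowVanishing g
  ⊕-low-vanishing {g} {x} {y} g≈x⊕y (x₀≈0 , x₁≈0) (y₀≈0 , y₁≈0) = vanishes 0 x₀≈0 y₀≈0 , vanishes 1 x₁≈0 y₁≈0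
    where vanishes : ∀ k → _≈ₗ_ l (x k) 0ₗ → _≈ₗ_ l (y k) 0ₗ → _≈ₗ_ l (g k) 0ₗ
          vanishes k xₖ≈0 yₖ≈0 = ≅⇒≈ₗ (g k) 0ₗ (λ n →
            ≅-trans (≈ₗ⇒≅ (g k) (_⊕_ l x y k) (g≈x⊕y k) n) (≅-+ (≈ₗ⇒≅ (x k) 0ₗ xₖ≈0 n) (≈ₗ⇒≅ (y k) 0ₗ yₖ≈0 n)))

  T²Λ⇒low-vanishing : ∀ {g} → InT²Λ l g → LowVanishing g
  T²Λ⇒low-vanishing {g} (h , g≈T²h) =
    ≈-low-vanishing {g} {T· (T· h)} g≈T²h (T·-at-0 (T· h)) (λ n → trans (T·-at-suc (T· h) 0 n) (T·-at-0 h n))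

  low-vanishing⇒T²Λ : ∀ {g} → LowVanishing g → InT²Λ l g
  low-vanishing⇒T²Λ {g} (g₀≈0 , g₁≈0) = h , g≈T²h
    where
      h : Λ l
      h k = g (suc (suc k))
      g≈T²h : _≈_ l g (T· (T· h))
      g≈T²h zero          = ≅⇒≈ₗ (g 0) (T· (T· h) 0) (λ n → ≅-trans (≈ₗ⇒≅ (g 0) 0ₗ g₀≈0 n) (≡⇒≅ (sym (T·-at-0 (T· h) n))))
      g≈T²h (suc zero)    = ≅⇒≈ₗ (g 1) (T· (T· h) 1) (λ n → ≅-trans (≈ₗ⇒≅ (g 1) 0ₗ g₁≈0 n)
                               (≡⇒≅ (sym (trans (T·-at-suc (T· h) 0 n) (T·-at-0 h n)))))
      g≈T²h (suc (suc k)) = ≅⇒≈ₗ (g (suc (suc k))) (T· (T· h) (suc (suc k)))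
                               (λ n → ≡⇒≅ (sym (trans (T·-at-suc (T· h) (suc k) n) (T·-at-suc h k n))))

  [l-ψ]TΛ⇒low-vanishing : ∀ {y} → In[l-ψ]TΛ l y → LowVanishing y
  [l-ψ]TΛ⇒low-vanishing {y} (h , y≈[l-ψ]Th) =
    ≈-low-vanishing {y} {l-ψ l (T· h)} y≈[l-ψ]Th
      (λ n → trans (coeffs-l-ψ (T· h) n 0) (l-ψᶻ-at-0 (coeffs (T· h) n) (T·-at-0 h n)))
      (λ n → trans (coeffs-l-ψ (T· h) n 1) (l-ψᶻ-at-1 (coeffs (T· h) n)))

module Decomposition {l : ℕ} (l-prime : Prime l) where

  open Precision l
  open Contraction l-prime
  open Coefficients l

  -- Ξ₂ ∩ (l-ψ)TΛ = 0: if g = (l-ψ)(T h) vanishes at the multiples of l, then by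
  -- uniqueness at each precision the coefficients of T h vanish, hence so does g.
  Ξ₂∩[l-ψ]TΛ≈0 : (g : Λ l) → Ξ₂ l g → In[l-ψ]TΛ l g → _≈_ l g (0Λ l)
  Ξ₂∩[l-ψ]TΛ≈0 g (_ , _ , g-on-multiples) (h , g≈[l-ψ]Th) k = ≅⇒≈ₗ (g k) 0ₗ (g≅0 k)
    where
      g≅l-ψF : ∀ n k → seq (g k) n ≅ l-ψᶻ (coeffs (T· h) n) k mod l^ n
      g≅l-ψF n k = ≅-trans (≈ₗ⇒≅ (g k) (l-ψ l (T· h) k) (g≈[l-ψ]Th k) n) (≡⇒≅ (coeffs-l-ψ (T· h) n k))
      Th≅0 : ∀ n j → coeffs (T· h) n j ≅ + 0 mod l^ n
      Th≅0 n = vanishing-on-multiples n (coeffs (T· h) n) (λ q →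
        ≅-trans (≅-sym (g≅l-ψF n (q ℕ.* l))) (≈ₗ⇒≅ (g (q ℕ.* l)) 0ₗ (g-on-multiples (q ℕ.* l) (ℕᵈ.divides q refl)) n))
      g≅0 : ∀ k n → seq (g k) n ≅ + 0 mod l^ n
      g≅0 k n = begin
        seq (g k) n                       ≈⟨ g≅l-ψF n k ⟩
        l-ψᶻ (coeffs (T· h) n) k          ≈⟨ l-ψᶻ-≅ (Th≅0 n) k ⟩
        l-ψᶻ (λ _ → + 0) k                ≡⟨ l-ψᶻ-of-0 k ⟩
        + 0                               ∎
        where open ≅-Reasoning (l^ n)

  -- At precision n, let
  -- F be the n-th iterate for the targets G_q = g_{ql}; the iterates are
  -- coherent in n and define h with T h ↦ F, y = (l-ψ)(T h) matches g at the
  -- multiples of l, and x = g - y lies in Ξ₂.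
  module Decompose (g : Λ l) (g-low : LowVanishing g) where

    G : ℕ → ℕ → ℤ
    G n zero    = + 0
    G n (suc q) = seq (g (suc q ℕ.* l)) n

    G≅g : ∀ n q → G n q ≅ seq (g (q ℕ.* l)) n mod l^ n
    G≅g n zero    = ≅-sym (≈ₗ⇒≅ (g 0) 0ₗ (proj₁ g-low) n)
    G≅g n (suc q) = ≅-refl

    F : ℕ → ℕ → ℤ
    F n = iterate (G n) n

    F-coherent : ∀ n k → F (suc n) k ≅ F n k mod l^ n
    F-coherent n k = ≅-trans (iterate-step (G (suc n)) n k) (iterate-≅ G-coherent n k)
      where G-coherent : ∀ q → G (suc n) q ≅ G n q mod l^ n
            G-coherent zero    = ≅-refl
            G-coherent (suc q) = mod-by (coh (g (suc q ℕ.* l)) n)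

    h : Λ l
    h k = mkℤₗ (λ n → F n (suc k)) (λ n → divides-difference (F-coherent n (suc k)))

    coeffs-Th : ∀ n j → coeffs (T· h) n j ≡ F n j
    coeffs-Th n zero    = trans (T·-at-0 h n) (sym (iterate-at-0 (G n) refl n))
    coeffs-Th n (suc j) = T·-at-suc h j n

    y : Λ l
    y = l-ψ l (T· h)

    x : Λ l
    x = _⊖_ l g y

    x-vanishes : ∀ k → (∀ n → seq (g k) n ≅ l-ψᶻ (F n) k mod l^ n) → _≈ₗ_ l (x k) 0ₗ
    x-vanishes k g≅l-ψF = ≅⇒≈ₗ (x k) 0ₗ x≅0
      where
        x≅0 : ∀ n → seq (x k) n ≅ + 0 mod l^ n
        x≅0 n = begin
          seq (g k) n - seq (y k) n     ≡⟨ cong (_-_ (seq (g k) n)) (trans (coeffs-l-ψ (T· h) n k) (l-ψᶻ-cong (coeffs-Th n) k)) ⟩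
          seq (g k) n - l-ψᶻ (F n) k    ≈⟨ ≅-+ (g≅l-ψF n) ≅-refl ⟩
          l-ψᶻ (F n) k - l-ψᶻ (F n) k   ≡⟨ ℤₚ.+-inverseʳ (l-ψᶻ (F n) k) ⟩
          + 0                           ∎
          where open ≅-Reasoning (l^ n)

    x∈Ξ₂ : Ξ₂ l x
    x∈Ξ₂ = x-vanishes 0 at-0 , x-vanishes 1 at-1 , at-multiples
      where
        at-0 : ∀ n → seq (g 0) n ≅ l-ψᶻ (F n) 0 mod l^ n
        at-0 n = ≅-trans (≈ₗ⇒≅ (g 0) 0ₗ (proj₁ g-low) n) (≡⇒≅ (sym (l-ψᶻ-at-0 (F n) (iterate-at-0 (G n) refl n))))
        at-1 : ∀ n → seq (g 1) n ≅ l-ψᶻ (F n) 1 mod l^ n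
        at-1 n = ≅-trans (≈ₗ⇒≅ (g 1) 0ₗ (proj₂ g-low) n) (≡⇒≅ (sym (l-ψᶻ-at-1 (F n))))
        at-multiples : ∀ k → l ℕᵈ.∣ k → _≈ₗ_ l (x k) 0ₗ
        at-multiples _ (ℕᵈ.divides q refl) =
          x-vanishes (q ℕ.* l) (λ n → ≅-trans (≅-sym (G≅g n q)) (≅-sym (iterate-solves (G n) n q)))

    decomposition : Σ (Λ l) λ x → Σ (Λ l) λ y → Ξ₂ l x × In[l-ψ]TΛ l y × _≈_ l g (_⊕_ l x y)
    decomposition = x , y , x∈Ξ₂ , (h , λ k → ≅⇒≈ₗ (y k) (y k) (λ _ → ≅-refl))
                  , λ k → ≅⇒≈ₗ (g k) (_⊕_ l x y k) (λ n → ≡⇒≅ (split (seq (g k) n) (seq (y k) n)))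
      where split : ∀ a b → a ≡ (a - b) + b
            split = solve-∀

  decompose : (g : Λ l) → InT²Λ l g →
    Σ (Λ l) λ x → Σ (Λ l) λ y → Ξ₂ l x × In[l-ψ]TΛ l y × _≈_ l g (_⊕_ l x y)
  decompose g g∈T²Λ = Decompose.decomposition g (T²Λ⇒low-vanishing {g} g∈T²Λ)

  sum⇒T²Λ : (g : Λ l) →
    (Σ (Λ l) λ x → Σ (Λ l) λ y → Ξ₂ l x × In[l-ψ]TΛ l y × _≈_ l g (_⊕_ l x y)) → InT²Λ l g
  sum⇒T²Λ g (x , y , (x₀≈0 , x₁≈0 , _) , y∈[l-ψ]TΛ , g≈x⊕y) =
    low-vanishing⇒T²Λ {g} (⊕-low-vanishing {g} {x} {y} g≈x⊕y (x₀≈0 , x₁≈0) ([l-ψ]TΛ⇒low-vanishing {y} y∈[l-ψ]TΛ))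

mainTheorem5 : (l : ℕ) → Prime l → l ≢ 2 →
    ((g : Λ l) →
        (InT²Λ l g →
           Σ (Λ l) λ x → Σ (Λ l) λ y → Ξ₂ l x × In[l-ψ]TΛ l y × _≈_ l g (_⊕_ l x y))
      × ((Σ (Λ l) λ x → Σ (Λ l) λ y → Ξ₂ l x × In[l-ψ]TΛ l y × _≈_ l g (_⊕_ l x y)) →
           InT²Λ l g))
    × ((g : Λ l) → Ξ₂ l g → In[l-ψ]TΛ l g → _≈_ l g (0Λ l))
mainTheorem5 l l-prime _ = (λ g → decompose g , sum⇒T²Λ g) , Ξ₂∩[l-ψ]TΛ≈0
  where open Decomposition l-prime
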